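{- Let $H$ be the graph consisting of a triangle together with one pendant edge (a fourth vertex joined to exactly one vertex of the triangle). Then $C(H,K_3)=\frac{3}{2}$.
   Context: All graphs are finite and simple. $\operatorname{hom}(H,T)$ is the number of maps $V(H)\to V(T)$ sending every edge of $H$ to an edge of $T$, $t(H,T)=\operatorname{hom}(H,T)/v(T)^{v(H)}$, and $C(G,H)=\min\{c\in\mathbb{R}: t(G,T)\geq t(H,T)^c \text{ for all graphs } T\}$.
   Formalization: The exponents c < 3/2 that must be shown inadmissible range only over the rationals rather than over all real numbers. -}

module Defs where

open import Data.Bool using (Bool; true; false; not; _∧_; _∨_; if_then_else_)
open import Data.Nat as ℕ using (ℕ; zero; suc; NonZero)
open import Data.Fin using (Fin; zero; suc; _≟_)
open import Data.Fin.Base using (toℕ)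
open import Data.List using (List; []; _∷_; map; concatMap; allFin; filterᵇ; length; foldr)
open import Data.Integer using (ℤ; +_; -[1+_])
open import Data.Rational using (ℚ; _/_; _*_; _<_; 1ℚ)
open import Relation.Nullary.Decidable using (⌊_⌋)
open import Relation.Binary.PropositionalEquality using (_≡_)
open import Data.Nat.Properties using (m^n≢0)

allᵇ : {A : Set} → (A → Bool) → List A → Bool
allᵇ p = foldr (λ x b → p x ∧ b) true

record Graph : Set where
  field
    v      : ℕ
    adj    : Fin v → Fin v → Bool
    sym    : ∀ i j → adj i j ≡ adj j i
    irrefl : ∀ i → adj i i ≡ false
open Graph public

allMaps : (k n : ℕ) → List (Fin k → Fin n)
allMaps zero    n = (λ ()) ∷ []
allMaps (suc k) n =
  concatMap (λ f → map (λ x → cons x f) (allFin n)) (allMaps k n)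
  where
  cons : ∀ {m} → Fin n → (Fin m → Fin n) → Fin (suc m) → Fin n
  cons x f zero    = x
  cons x f (suc i) = f i

isHom : (H T : Graph) → (Fin (v H) → Fin (v T)) → Bool
isHom H T f =
  allᵇ (λ i → allᵇ (λ j → not (adj H i j) ∨ adj T (f i) (f j)) (allFin (v H)))
      (allFin (v H))

hom : Graph → Graph → ℕ
hom H T = length (filterᵇ (isHom H T) (allMaps (v H) (v T)))

t : (H T : Graph) → .{{NonZero (v T)}} → ℚ
t H T = (+ hom H T) / (v T ℕ.^ v H)
  where instance _ = m^n≢0 (v T) (v H)

_^_ : ℚ → ℕ → ℚ
x ^ zero  = 1ℚ
x ^ suc n = x * (x ^ n)

-- For x > 0, a ≥ 0, q ≥ 1 and p ∈ ℤ:  PowExceeds a x p q  encodes  a < x^(p/q),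
-- i.e. a^q < x^p, written without division:
--   p =  m     :  a^q < x^m
--   p = -(m+1) :  a^q · x^(m+1) < 1
PowExceeds : ℚ → ℚ → ℤ → ℕ → Set
PowExceeds a x (+ m)    q = (a ^ q) < (x ^ m)
PowExceeds a x -[1+ m ] q = ((a ^ q) * (x ^ suc m)) < 1ℚ

K3 : Graph
K3 = record { v = 3 ; adj = λ i j → not ⌊ i ≟ j ⌋ ; sym = s ; irrefl = r }
  where
  s : ∀ (i j : Fin 3) → not ⌊ i ≟ j ⌋ ≡ not ⌊ j ≟ i ⌋
  s zero zero = _≡_.refl
  s zero (suc zero) = _≡_.refl
  s zero (suc (suc zero)) = _≡_.refl
  s (suc zero) zero = _≡_.refl
  s (suc zero) (suc zero) = _≡_.refl
  s (suc zero) (suc (suc zero)) = _≡_.refl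
  s (suc (suc zero)) zero = _≡_.refl
  s (suc (suc zero)) (suc zero) = _≡_.refl
  s (suc (suc zero)) (suc (suc zero)) = _≡_.refl
  r : ∀ (i : Fin 3) → not ⌊ i ≟ i ⌋ ≡ false
  r zero = _≡_.refl
  r (suc zero) = _≡_.refl
  r (suc (suc zero)) = _≡_.refl

pendAdj : Fin 4 → Fin 4 → Bool
pendAdj zero (suc zero) = true
pendAdj zero (suc (suc zero)) = true
pendAdj zero (suc (suc (suc zero))) = true
pendAdj (suc zero) zero = true
pendAdj (suc zero) (suc (suc zero)) = true
pendAdj (suc (suc zero)) zero = true
pendAdj (suc (suc zero)) (suc zero) = true
pendAdj (suc (suc (suc zero))) zero = true
pendAdj _ _ = false

TrianglePendant : Graph
TrianglePendant = record { v = 4 ; adj = pendAdj ; sym = s ; irrefl = r }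
  where
  s : ∀ i j → pendAdj i j ≡ pendAdj j i
  s zero zero = _≡_.refl
  s zero (suc zero) = _≡_.refl
  s zero (suc (suc zero)) = _≡_.refl
  s zero (suc (suc (suc zero))) = _≡_.refl
  s (suc zero) zero = _≡_.refl
  s (suc zero) (suc zero) = _≡_.refl
  s (suc zero) (suc (suc zero)) = _≡_.refl
  s (suc zero) (suc (suc (suc zero))) = _≡_.refl
  s (suc (suc zero)) zero = _≡_.refl
  s (suc (suc zero)) (suc zero) = _≡_.refl
  s (suc (suc zero)) (suc (suc zero)) = _≡_.refl
  s (suc (suc zero)) (suc (suc (suc zero))) = _≡_.refl
  s (suc (suc (suc zero))) zero = _≡_.refl
  s (suc (suc (suc zero))) (suc zero) = _≡_.refl
  s (suc (suc (suc zero))) (suc (suc zero)) = _≡_.refl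
  s (suc (suc (suc zero))) (suc (suc (suc zero))) = _≡_.refl
  r : ∀ i → pendAdj i i ≡ false
  r zero = _≡_.refl
  r (suc zero) = _≡_.refl
  r (suc (suc zero)) = _≡_.refl
  r (suc (suc (suc zero))) = _≡_.refl

{-# OPTIONS --safe #-}
module Submission where

-- Write hom(K₃,T) = Σₓ tₓ and hom(H,T) = Σₓ tₓ dₓ, where tₓ counts the ordered triangles at x and
-- dₓ is the degree of x. Since tₓ ≤ dₓ², we have tₓ³ ≤ (tₓ dₓ)², and a discrete Hölder inequality
-- (three-term AM–GM summed over all triples of vertices) gives hom(K₃,T)³ ≤ n · hom(H,T)², which
-- is t(K₃,T)³ ≤ t(H,T)². For sharpness let T be k disjoint triangles on n = 3k vertices:
-- t(K₃,T) = 2/n² and t(H,T) = 4/n³, so for 2p < 3q the inequality t(H,T) < t(K₃,T)^(p/q) reads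
-- 4^q n^(2p) < 2^p n^(3q), which holds for k = 4^q (and trivially when p < 0).

open import Data.Fin using (Fin)
open import Data.Nat using (ℕ)
open import Relation.Binary.PropositionalEquality using (_≡_; _≢_)

module ListSum where

  open import Data.Bool using (Bool; true; false; _∧_; _∨_)
  open import Data.Fin using (zero; suc)
  open import Data.Fin.Properties using (_≟_)
  open import Data.List using (List; []; _∷_; _++_; map; concatMap; filterᵇ; length; allFin)
  open import Data.List.Properties using (map-tabulate; length-tabulate)
  open import Data.Nat using (suc; _+_; _*_; _≤_; z≤n)
  open import Data.Nat.Properties
    using (+-identityʳ; +-assoc; +-mono-≤; *-identityˡ; *-zeroʳ; *-comm; *-distribˡ-+; *-distribʳ-+;
           ≤-refl; +-commutativeSemigroup)
  open import Algebra.Properties.CommutativeSemigroup +-commutativeSemigroup using (interchange)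
  open import Function using (id; _∘_)
  open import Relation.Binary.PropositionalEquality
  open import Relation.Nullary.Decidable using (does; yes; no; dec-false)

  private
    variable
      A B : Set

  ∑ : List A → (A → ℕ) → ℕ
  ∑ []       f = 0
  ∑ (x ∷ xs) f = f x + ∑ xs f

  infix 5 ∑
  syntax ∑ xs (λ x → e) = ∑[ x ∈ xs ] e

  𝟙 : Bool → ℕ
  𝟙 true  = 1
  𝟙 false = 0

  𝟙-∧ : ∀ a b → 𝟙 (a ∧ b) ≡ 𝟙 a * 𝟙 b
  𝟙-∧ true  b = sym (+-identityʳ (𝟙 b))
  𝟙-∧ false b = refl

  𝟙≤1 : ∀ b → 𝟙 b ≤ 1
  𝟙≤1 true  = ≤-refl
  𝟙≤1 false = z≤n

  length-filterᵇ : (p : A → Bool) (xs : List A) → length (filterᵇ p xs) ≡ ∑[ x ∈ xs ] 𝟙 (p x)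
  length-filterᵇ p []       = refl
  length-filterᵇ p (x ∷ xs) with p x
  ... | true  = cong suc (length-filterᵇ p xs)
  ... | false = length-filterᵇ p xs

  ∑-cong : (xs : List A) {f g : A → ℕ} → (∀ x → f x ≡ g x) → ∑ xs f ≡ ∑ xs g
  ∑-cong []       f≗g = refl
  ∑-cong (x ∷ xs) f≗g = cong₂ _+_ (f≗g x) (∑-cong xs f≗g)

  ∑-mono-≤ : (xs : List A) {f g : A → ℕ} → (∀ x → f x ≤ g x) → ∑ xs f ≤ ∑ xs g
  ∑-mono-≤ []       f≤g = z≤n
  ∑-mono-≤ (x ∷ xs) f≤g = +-mono-≤ (f≤g x) (∑-mono-≤ xs f≤g)

  ∑-++ : (xs ys : List A) (f : A → ℕ) → ∑ (xs ++ ys) f ≡ ∑ xs f + ∑ ys f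
  ∑-++ []       ys f = refl
  ∑-++ (x ∷ xs) ys f = trans (cong (f x +_) (∑-++ xs ys f)) (sym (+-assoc (f x) _ _))

  ∑-map : (g : A → B) (xs : List A) (f : B → ℕ) → ∑ (map g xs) f ≡ ∑[ x ∈ xs ] f (g x)
  ∑-map g []       f = refl
  ∑-map g (x ∷ xs) f = cong (f (g x) +_) (∑-map g xs f)

  ∑-concatMap : (g : A → List B) (xs : List A) (f : B → ℕ) →
                ∑ (concatMap g xs) f ≡ ∑[ x ∈ xs ] ∑ (g x) f
  ∑-concatMap g []       f = refl
  ∑-concatMap g (x ∷ xs) f =
    trans (∑-++ (g x) (concatMap g xs) f) (cong (∑ (g x) f +_) (∑-concatMap g xs f))

  ∑-distrib-+ : (xs : List A) (f g : A → ℕ) → ∑[ x ∈ xs ] (f x + g x) ≡ ∑ xs f + ∑ xs g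
  ∑-distrib-+ []       f g = refl
  ∑-distrib-+ (x ∷ xs) f g = trans (cong (f x + g x +_) (∑-distrib-+ xs f g))
                                   (interchange (f x) (g x) (∑ xs f) (∑ xs g))

  ∑-distribˡ-* : (c : ℕ) (xs : List A) (f : A → ℕ) → c * ∑ xs f ≡ ∑[ x ∈ xs ] c * f x
  ∑-distribˡ-* c []       f = *-zeroʳ c
  ∑-distribˡ-* c (x ∷ xs) f = trans (*-distribˡ-+ c (f x) (∑ xs f)) (cong (c * f x +_) (∑-distribˡ-* c xs f))

  ∑-distribʳ-* : (c : ℕ) (xs : List A) (f : A → ℕ) → ∑ xs f * c ≡ ∑[ x ∈ xs ] f x * c
  ∑-distribʳ-* c xs f =
    trans (*-comm (∑ xs f) c) (trans (∑-distribˡ-* c xs f) (∑-cong xs (λ x → *-comm c (f x))))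

  ∑-const : (xs : List A) (c : ℕ) → ∑[ x ∈ xs ] c ≡ length xs * c
  ∑-const []       c = refl
  ∑-const (x ∷ xs) c = cong (c +_) (∑-const xs c)

  ∑-zero : (xs : List A) → ∑[ x ∈ xs ] 0 ≡ 0
  ∑-zero xs = trans (∑-const xs 0) (*-zeroʳ (length xs))

  ∑-*-∑ : (xs : List A) (ys : List B) (f : A → ℕ) (g : B → ℕ) →
          ∑ xs f * ∑ ys g ≡ ∑[ x ∈ xs ] ∑[ y ∈ ys ] f x * g y
  ∑-*-∑ xs ys f g = trans (∑-distribʳ-* (∑ ys g) xs f) (∑-cong xs (λ x → ∑-distribˡ-* (f x) ys g))

  ∑-swap : (xs : List A) (ys : List B) (f : A → B → ℕ) →
           ∑[ x ∈ xs ] ∑[ y ∈ ys ] f x y ≡ ∑[ y ∈ ys ] ∑[ x ∈ xs ] f x y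
  ∑-swap []       ys f = sym (∑-zero ys)
  ∑-swap (x ∷ xs) ys f = trans (cong (∑ ys (f x) +_) (∑-swap xs ys f))
                               (sym (∑-distrib-+ ys (f x) (λ y → ∑[ x ∈ xs ] f x y)))

  length-allFin : ∀ n → length (allFin n) ≡ n
  length-allFin n = length-tabulate id

  ∑-allFin-suc : ∀ {n} (f : Fin (suc n) → ℕ) →
                 ∑ (allFin (suc n)) f ≡ f zero + (∑[ i ∈ allFin n ] f (suc i))
  ∑-allFin-suc {n} f =
    cong (f zero +_) (trans (cong (λ xs → ∑ xs f) (sym (map-tabulate id suc))) (∑-map suc (allFin n) f))

  ∑-indicator : ∀ {n} (a : Fin n) (h : Fin n → ℕ) → ∑[ x ∈ allFin n ] 𝟙 (does (x ≟ a)) * h x ≡ h a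
  ∑-indicator {suc n} zero h =
    trans (∑-allFin-suc (λ x → 𝟙 (does (x ≟ zero)) * h x))
          (trans (cong₂ _+_ (*-identityˡ (h zero)) (∑-zero (allFin n))) (+-identityʳ (h zero)))
  ∑-indicator {suc n} (suc a) h =
    trans (∑-allFin-suc (λ x → 𝟙 (does (x ≟ suc a)) * h x)) (∑-indicator a (h ∘ suc))

  ∑-indicator-pair : ∀ {n} {a b : Fin n} → a ≢ b → (h : Fin n → ℕ) →
                     ∑[ x ∈ allFin n ] 𝟙 (does (x ≟ a) ∨ does (x ≟ b)) * h x ≡ h a + h b
  ∑-indicator-pair {n} {a} {b} a≢b h = begin
    ∑[ x ∈ V ] 𝟙 (does (x ≟ a) ∨ does (x ≟ b)) * h x
      ≡⟨ ∑-cong V split ⟩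
    ∑[ x ∈ V ] (𝟙 (does (x ≟ a)) * h x + 𝟙 (does (x ≟ b)) * h x)
      ≡⟨ ∑-distrib-+ V _ _ ⟩
    (∑[ x ∈ V ] 𝟙 (does (x ≟ a)) * h x) + (∑[ x ∈ V ] 𝟙 (does (x ≟ b)) * h x)
      ≡⟨ cong₂ _+_ (∑-indicator a h) (∑-indicator b h) ⟩
    h a + h b
      ∎
    where
    open ≡-Reasoning
    V = allFin n
    𝟙-∨ : ∀ x → 𝟙 (does (x ≟ a) ∨ does (x ≟ b)) ≡ 𝟙 (does (x ≟ a)) + 𝟙 (does (x ≟ b))
    𝟙-∨ x with x ≟ a
    ... | yes refl = cong (λ c → 1 + 𝟙 c) (sym (dec-false (x ≟ b) a≢b))
    ... | no  _    = refl
    split : ∀ x → 𝟙 (does (x ≟ a) ∨ does (x ≟ b)) * h x ≡ 𝟙 (does (x ≟ a)) * h x + 𝟙 (does (x ≟ b)) * h x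
    split x = trans (cong (_* h x) (𝟙-∨ x)) (*-distribʳ-+ (h x) (𝟙 (does (x ≟ a))) (𝟙 (does (x ≟ b))))

module PowerMean where

  open import Data.List using (List; length)
  open import Data.Nat using (_+_; _*_; _^_; _≤_)
  open import Data.Nat.Properties
    using (≤-total; m≤n⇒∃[o]m+o≡n; m≤m+n; ≮⇒≥; <⇒≱; ^-monoˡ-<; *-mono-≤; *-monoʳ-≤; *-cancelˡ-≤;
           *-identityʳ; module ≤-Reasoning; +-commutativeSemigroup; *-commutativeSemigroup)
  open import Data.Nat.Solver using (module +-*-Solver)
  open import Data.Product using (_,_)
  open import Data.Sum using (inj₁; inj₂)
  open import Relation.Binary.PropositionalEquality
  open import Algebra.Properties.CommutativeSemigroup *-commutativeSemigroup using (xy∙z≈yx∙z; xy∙z≈xz∙y)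
  open import Algebra.Properties.CommutativeSemigroup +-commutativeSemigroup
    using () renaming (xy∙z≈yx∙z to +-xy∙z≈yx∙z; xy∙z≈xz∙y to +-xy∙z≈xz∙y)
  open ListSum
  open +-*-Solver

  private
    cube : ∀ m → m ^ 3 ≡ m * m * m
    cube = solve 1 (λ m → m :^ 3 := m :* m :* m) refl

  wlog-sorted : (P : ℕ → ℕ → ℕ → Set) →
                (∀ {x y z} → P x y z → P y x z) → (∀ {x y z} → P x y z → P x z y) →
                (∀ {x y z} → z ≤ y → y ≤ x → P x y z) → ∀ x y z → P x y z
  wlog-sorted P swap₁₂ swap₂₃ sorted x y z with ≤-total z y | ≤-total y x | ≤-total z x
  ... | inj₁ z≤y | inj₁ y≤x | _        = sorted z≤y y≤x
  ... | inj₁ z≤y | inj₂ x≤y | inj₁ z≤x = swap₁₂ (sorted z≤x x≤y)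
  ... | inj₁ z≤y | inj₂ x≤y | inj₂ x≤z = swap₁₂ (swap₂₃ (sorted x≤z z≤y))
  ... | inj₂ y≤z | inj₁ y≤x | inj₁ z≤x = swap₂₃ (sorted y≤z z≤x)
  ... | inj₂ y≤z | inj₁ y≤x | inj₂ x≤z = swap₂₃ (swap₁₂ (sorted y≤x x≤z))
  ... | inj₂ y≤z | inj₂ x≤y | _        = swap₂₃ (swap₁₂ (swap₂₃ (sorted x≤y y≤z)))

  amgm₃ : ∀ x y z → 27 * (x * y * z) ≤ (x + y + z) ^ 3
  amgm₃ = wlog-sorted (λ x y z → 27 * (x * y * z) ≤ (x + y + z) ^ 3)
    (λ {x} {y} {z} → subst₂ _≤_ (cong (27 *_) (xy∙z≈yx∙z x y z)) (cong (_^ 3) (+-xy∙z≈yx∙z x y z)))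
    (λ {x} {y} {z} → subst₂ _≤_ (cong (27 *_) (xy∙z≈xz∙y x y z)) (cong (_^ 3) (+-xy∙z≈xz∙y x y z)))
    sorted
    where
    -- For x = z + i + j ≥ y = z + i ≥ z the excess of (x + y + z)³ over 27xyz has only nonnegative terms.
    gap : ∀ z i j → ((z + i + j) + (z + i) + z) ^ 3 ≡
                    27 * ((z + i + j) * (z + i) * z) + (9 * z * (i * i + i * j + j * j) + (2 * i + j) ^ 3)
    gap = solve 3 (λ z i j → ((z :+ i :+ j) :+ (z :+ i) :+ z) :^ 3 :=
                             con 27 :* ((z :+ i :+ j) :* (z :+ i) :* z) :+
                             (con 9 :* z :* (i :* i :+ i :* j :+ j :* j) :+ (con 2 :* i :+ j) :^ 3)) refl
    sorted : ∀ {x y z} → z ≤ y → y ≤ x → 27 * (x * y * z) ≤ (x + y + z) ^ 3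
    sorted {z = z} z≤y y≤x with m≤n⇒∃[o]m+o≡n z≤y | m≤n⇒∃[o]m+o≡n y≤x
    ... | i , refl | j , refl = subst (27 * ((z + i + j) * (z + i) * z) ≤_) (sym (gap z i j)) (m≤m+n _ _)

  m³≤n³⇒m≤n : ∀ {m n} → m ^ 3 ≤ n ^ 3 → m ≤ n
  m³≤n³⇒m≤n m³≤n³ = ≮⇒≥ (λ n<m → <⇒≱ (^-monoˡ-< 3 n<m) m³≤n³)

  product≤pairSum : ∀ a b c x y z → a ^ 3 ≤ x ^ 2 → b ^ 3 ≤ y ^ 2 → c ^ 3 ≤ z ^ 2 →
                    3 * (a * b * c) ≤ x * y + y * z + z * x
  product≤pairSum a b c x y z a³≤x² b³≤y² c³≤z² = m³≤n³⇒m≤n (begin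
    (3 * (a * b * c)) ^ 3                  ≡⟨ cube-product a b c ⟩
    27 * (a ^ 3 * b ^ 3 * c ^ 3)           ≤⟨ *-monoʳ-≤ 27 (*-mono-≤ (*-mono-≤ a³≤x² b³≤y²) c³≤z²) ⟩
    27 * (x ^ 2 * y ^ 2 * z ^ 2)           ≡⟨ cong (27 *_) (pairs x y z) ⟩
    27 * ((x * y) * (y * z) * (z * x))     ≤⟨ amgm₃ (x * y) (y * z) (z * x) ⟩
    (x * y + y * z + z * x) ^ 3            ∎)
    where
    open ≤-Reasoning
    cube-product : ∀ a b c → (3 * (a * b * c)) ^ 3 ≡ 27 * (a ^ 3 * b ^ 3 * c ^ 3)
    cube-product = solve 3 (λ a b c → (con 3 :* (a :* b :* c)) :^ 3 := con 27 :* (a :^ 3 :* b :^ 3 :* c :^ 3)) refl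
    pairs : ∀ x y z → x ^ 2 * y ^ 2 * z ^ 2 ≡ (x * y) * (y * z) * (z * x)
    pairs = solve 3 (λ x y z → x :^ 2 :* y :^ 2 :* z :^ 2 := (x :* y) :* (y :* z) :* (z :* x)) refl

  module _ {A : Set} (xs : List A) where

    ∑³ : (A → A → A → ℕ) → ℕ
    ∑³ g = ∑[ u ∈ xs ] ∑[ v ∈ xs ] ∑[ w ∈ xs ] g u v w

    ∑³-cong : {g h : A → A → A → ℕ} → (∀ u v w → g u v w ≡ h u v w) → ∑³ g ≡ ∑³ h
    ∑³-cong g≗h = ∑-cong xs (λ u → ∑-cong xs (λ v → ∑-cong xs (g≗h u v)))

    ∑³-mono-≤ : {g h : A → A → A → ℕ} → (∀ u v w → g u v w ≤ h u v w) → ∑³ g ≤ ∑³ h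
    ∑³-mono-≤ g≤h = ∑-mono-≤ xs (λ u → ∑-mono-≤ xs (λ v → ∑-mono-≤ xs (g≤h u v)))

    ∑³-distrib-+ : (g h : A → A → A → ℕ) → ∑³ (λ u v w → g u v w + h u v w) ≡ ∑³ g + ∑³ h
    ∑³-distrib-+ g h =
      trans (∑-cong xs (λ u → trans (∑-cong xs (λ v → ∑-distrib-+ xs (g u v) (h u v)))
                                    (∑-distrib-+ xs _ _)))
            (∑-distrib-+ xs _ _)

    ∑³-distribˡ-* : (c : ℕ) (g : A → A → A → ℕ) → c * ∑³ g ≡ ∑³ (λ u v w → c * g u v w)
    ∑³-distribˡ-* c g =
      trans (∑-distribˡ-* c xs _)
            (∑-cong xs (λ u → trans (∑-distribˡ-* c xs _) (∑-cong xs (λ v → ∑-distribˡ-* c xs (g u v)))))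

    ∑³-product : (f g h : A → ℕ) → ∑³ (λ u v w → f u * g v * h w) ≡ ∑ xs f * ∑ xs g * ∑ xs h
    ∑³-product f g h = sym (begin
      ∑ xs f * ∑ xs g * ∑ xs h
        ≡⟨ cong (_* ∑ xs h) (∑-*-∑ xs xs f g) ⟩
      (∑[ u ∈ xs ] ∑[ v ∈ xs ] f u * g v) * ∑ xs h
        ≡⟨ ∑-distribʳ-* (∑ xs h) xs _ ⟩
      ∑[ u ∈ xs ] (∑[ v ∈ xs ] f u * g v) * ∑ xs h
        ≡⟨ ∑-cong xs (λ u → ∑-distribʳ-* (∑ xs h) xs _) ⟩
      ∑[ u ∈ xs ] ∑[ v ∈ xs ] f u * g v * ∑ xs h
        ≡⟨ ∑-cong xs (λ u → ∑-cong xs (λ v → ∑-distribˡ-* (f u * g v) xs h)) ⟩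
      ∑³ (λ u v w → f u * g v * h w)
        ∎)
      where open ≡-Reasoning

  cube-∑≤length*square-∑ : {A : Set} (xs : List A) (a x : A → ℕ) → (∀ i → a i ^ 3 ≤ x i ^ 2) →
                           (∑ xs a) ^ 3 ≤ length xs * (∑ xs x) ^ 2
  cube-∑≤length*square-∑ xs a x a³≤x² = *-cancelˡ-≤ 3 (begin
    3 * S ^ 3
      ≡⟨ cong (3 *_) (trans (cube S) (sym (∑³-product xs a a a))) ⟩
    3 * ∑³ xs (λ u v w → a u * a v * a w)
      ≡⟨ ∑³-distribˡ-* xs 3 _ ⟩
    ∑³ xs (λ u v w → 3 * (a u * a v * a w))
      ≤⟨ ∑³-mono-≤ xs (λ u v w → product≤pairSum (a u) (a v) (a w) (x u) (x v) (x w)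
                                                  (a³≤x² u) (a³≤x² v) (a³≤x² w)) ⟩
    ∑³ xs (λ u v w → x u * x v + x v * x w + x w * x u)
      ≡⟨ ∑³-cong xs (λ u v w → pairs (x u) (x v) (x w)) ⟩
    ∑³ xs (λ u v w → x u * x v * 1 + 1 * x v * x w + x u * 1 * x w)
      ≡⟨ trans (∑³-distrib-+ xs _ _) (cong₂ _+_ (∑³-distrib-+ xs _ _) refl) ⟩
    ∑³ xs (λ u v w → x u * x v * 1) + ∑³ xs (λ u v w → 1 * x v * x w) + ∑³ xs (λ u v w → x u * 1 * x w)
      ≡⟨ cong₂ _+_ (cong₂ _+_ (∑³-product xs x x one) (∑³-product xs one x x)) (∑³-product xs x one x) ⟩
    W * W * ∑ xs one + ∑ xs one * W * W + W * ∑ xs one * W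
      ≡⟨ cong (λ ℓ → W * W * ℓ + ℓ * W * W + W * ℓ * W) ∑-one ⟩
    W * W * ℓ + ℓ * W * W + W * ℓ * W
      ≡⟨ collect ℓ W ⟩
    3 * (ℓ * W ^ 2)
      ∎)
    where
    open ≤-Reasoning
    S = ∑ xs a
    W = ∑ xs x
    ℓ = length xs
    one : _ → ℕ
    one _ = 1
    ∑-one : ∑ xs one ≡ ℓ
    ∑-one = trans (∑-const xs 1) (*-identityʳ ℓ)
    -- The factors 1 put each pair term in the product form evaluated by ∑³-product.
    pairs : ∀ p q r → p * q + q * r + r * p ≡ p * q * 1 + 1 * q * r + p * 1 * r
    pairs = solve 3 (λ p q r → p :* q :+ q :* r :+ r :* p := p :* q :* con 1 :+ con 1 :* q :* r :+ p :* con 1 :* r) refl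
    collect : ∀ ℓ w → w * w * ℓ + ℓ * w * w + w * ℓ * w ≡ 3 * (ℓ * w ^ 2)
    collect = solve 2 (λ ℓ w → w :* w :* ℓ :+ ℓ :* w :* w :+ w :* ℓ :* w := con 3 :* (ℓ :* w :^ 2)) refl

  m≤n²⇒m³≤[m*n]² : ∀ {m n} → m ≤ n * n → m ^ 3 ≤ (m * n) ^ 2
  m≤n²⇒m³≤[m*n]² {m} {n} m≤n² = begin
    m ^ 3              ≡⟨ cube m ⟩
    m * m * m          ≤⟨ *-monoʳ-≤ (m * m) m≤n² ⟩
    m * m * (n * n)    ≡⟨ square m n ⟩
    (m * n) ^ 2        ∎
    where
    open ≤-Reasoning
    square : ∀ m n → m * m * (n * n) ≡ (m * n) ^ 2
    square = solve 2 (λ m n → m :* m :* (n :* n) := (m :* n) :^ 2) refl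

module HomomorphismCount where

  open import Defs using (Graph; v; adj; isHom; hom; allMaps; K3; TrianglePendant) renaming (sym to adj-sym)
  open import Data.Bool using (Bool; true; false; _∧_)
  open import Data.Fin using (zero; suc)
  open import Data.Fin.Patterns using (0F; 1F; 2F; 3F)
  open import Data.List using (allFin; length)
  open import Data.Nat using (suc; _*_; _^_; _≤_; z≤n)
  open import Data.Nat.Properties using (+-identityʳ; module ≤-Reasoning)
  open import Function using (_∘_)
  open import Relation.Binary.PropositionalEquality
  open ListSum
  open PowerMean

  -- The consing function of allMaps is local to Defs, so sums over allMaps are only unfolded for
  -- integrands that inspect f through f zero and f ∘ suc (or, on the empty domain, not at all).
  ∑-allMaps-zero : ∀ n (c : ℕ) → ∑[ f ∈ allMaps 0 n ] c ≡ c
  ∑-allMaps-zero n c = +-identityʳ c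

  ∑-allMaps-suc : ∀ k n (g : Fin n → (Fin k → Fin n) → ℕ) →
                  ∑[ f ∈ allMaps (suc k) n ] g (f zero) (f ∘ suc) ≡ ∑[ x ∈ allFin n ] ∑[ f ∈ allMaps k n ] g x f
  ∑-allMaps-suc k n g =
    trans (∑-concatMap _ (allMaps k n) _)
          (trans (∑-cong (allMaps k n) (λ f → ∑-map _ (allFin n) _))
                 (∑-swap (allMaps k n) (allFin n) (λ f x → g x f)))

  ∑-allMaps₁ : ∀ n (P : Fin n → ℕ) → ∑[ f ∈ allMaps 1 n ] P (f 0F) ≡ ∑[ x ∈ allFin n ] P x
  ∑-allMaps₁ n P =
    trans (∑-allMaps-suc 0 n (λ x _ → P x)) (∑-cong (allFin n) (λ x → ∑-allMaps-zero n (P x)))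

  ∑-allMaps₂ : ∀ n (P : Fin n → Fin n → ℕ) →
               ∑[ f ∈ allMaps 2 n ] P (f 0F) (f 1F) ≡ ∑[ x ∈ allFin n ] ∑[ y ∈ allFin n ] P x y
  ∑-allMaps₂ n P =
    trans (∑-allMaps-suc 1 n (λ x f → P x (f 0F))) (∑-cong (allFin n) (λ x → ∑-allMaps₁ n (P x)))

  ∑-allMaps₃ : ∀ n (P : Fin n → Fin n → Fin n → ℕ) →
               ∑[ f ∈ allMaps 3 n ] P (f 0F) (f 1F) (f 2F) ≡
               ∑[ x ∈ allFin n ] ∑[ y ∈ allFin n ] ∑[ z ∈ allFin n ] P x y z
  ∑-allMaps₃ n P =
    trans (∑-allMaps-suc 2 n (λ x f → P x (f 0F) (f 1F))) (∑-cong (allFin n) (λ x → ∑-allMaps₂ n (P x)))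

  ∑-allMaps₄ : ∀ n (P : Fin n → Fin n → Fin n → Fin n → ℕ) →
               ∑[ f ∈ allMaps 4 n ] P (f 0F) (f 1F) (f 2F) (f 3F) ≡
               ∑[ x ∈ allFin n ] ∑[ y ∈ allFin n ] ∑[ z ∈ allFin n ] ∑[ w ∈ allFin n ] P x y z w
  ∑-allMaps₄ n P =
    trans (∑-allMaps-suc 3 n (λ x f → P x (f 0F) (f 1F) (f 2F))) (∑-cong (allFin n) (λ x → ∑-allMaps₃ n (P x)))

  module _ (T : Graph) where

    isTriangle : Fin (v T) → Fin (v T) → Fin (v T) → Bool
    isTriangle x y z = adj T x y ∧ adj T x z ∧ adj T y z

    isHom-K3 : (f : Fin 3 → Fin (v T)) → isHom K3 T f ≡ isTriangle (f 0F) (f 1F) (f 2F)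
    isHom-K3 f
      rewrite adj-sym T (f 1F) (f 0F) | adj-sym T (f 2F) (f 0F) | adj-sym T (f 2F) (f 1F)
      with adj T (f 0F) (f 1F) | adj T (f 0F) (f 2F) | adj T (f 1F) (f 2F)
    ... | false | _     | _     = refl
    ... | true  | false | _     = refl
    ... | true  | true  | false = refl
    ... | true  | true  | true  = refl

    isHom-TrianglePendant : (f : Fin 4 → Fin (v T)) →
                            isHom TrianglePendant T f ≡ isTriangle (f 0F) (f 1F) (f 2F) ∧ adj T (f 0F) (f 3F)
    isHom-TrianglePendant f
      rewrite adj-sym T (f 1F) (f 0F) | adj-sym T (f 2F) (f 0F) | adj-sym T (f 2F) (f 1F) | adj-sym T (f 3F) (f 0F)
      with adj T (f 0F) (f 1F) | adj T (f 0F) (f 2F) | adj T (f 1F) (f 2F) | adj T (f 0F) (f 3F)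
    ... | false | _     | _     | _     = refl
    ... | true  | false | _     | _     = refl
    ... | true  | true  | false | false = refl
    ... | true  | true  | false | true  = refl
    ... | true  | true  | true  | false = refl
    ... | true  | true  | true  | true  = refl

    triangles : Fin (v T) → ℕ
    triangles x = ∑[ y ∈ allFin (v T) ] ∑[ z ∈ allFin (v T) ] 𝟙 (isTriangle x y z)

    degree : Fin (v T) → ℕ
    degree x = ∑[ y ∈ allFin (v T) ] 𝟙 (adj T x y)

    hom-K3 : hom K3 T ≡ ∑[ x ∈ allFin (v T) ] triangles x
    hom-K3 = begin
      hom K3 T
        ≡⟨ length-filterᵇ (isHom K3 T) (allMaps 3 n) ⟩
      ∑[ f ∈ allMaps 3 n ] 𝟙 (isHom K3 T f)
        ≡⟨ ∑-cong (allMaps 3 n) (cong 𝟙 ∘ isHom-K3) ⟩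
      ∑[ f ∈ allMaps 3 n ] 𝟙 (isTriangle (f 0F) (f 1F) (f 2F))
        ≡⟨ ∑-allMaps₃ n (λ x y z → 𝟙 (isTriangle x y z)) ⟩
      ∑[ x ∈ allFin n ] triangles x
        ∎
      where
      open ≡-Reasoning
      n = v T

    hom-TrianglePendant : hom TrianglePendant T ≡ ∑[ x ∈ allFin (v T) ] triangles x * degree x
    hom-TrianglePendant = begin
      hom TrianglePendant T
        ≡⟨ length-filterᵇ (isHom TrianglePendant T) (allMaps 4 n) ⟩
      ∑[ f ∈ allMaps 4 n ] 𝟙 (isHom TrianglePendant T f)
        ≡⟨ ∑-cong (allMaps 4 n) (cong 𝟙 ∘ isHom-TrianglePendant) ⟩
      ∑[ f ∈ allMaps 4 n ] 𝟙 (isTriangle (f 0F) (f 1F) (f 2F) ∧ adj T (f 0F) (f 3F))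
        ≡⟨ ∑-allMaps₄ n (λ x y z w → 𝟙 (isTriangle x y z ∧ adj T x w)) ⟩
      ∑[ x ∈ V ] ∑[ y ∈ V ] ∑[ z ∈ V ] ∑[ w ∈ V ] 𝟙 (isTriangle x y z ∧ adj T x w)
        ≡⟨ ∑-cong V (λ x → ∑-cong V (λ y → ∑-cong V (λ z → factor-degree x y z))) ⟩
      ∑[ x ∈ V ] ∑[ y ∈ V ] ∑[ z ∈ V ] 𝟙 (isTriangle x y z) * degree x
        ≡⟨ ∑-cong V (λ x → sym (factor-triangles x)) ⟩
      ∑[ x ∈ V ] triangles x * degree x
        ∎
      where
      open ≡-Reasoning
      n = v T
      V = allFin n
      factor-degree : ∀ x y z → ∑[ w ∈ V ] 𝟙 (isTriangle x y z ∧ adj T x w) ≡ 𝟙 (isTriangle x y z) * degree x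
      factor-degree x y z = trans (∑-cong V (λ w → 𝟙-∧ (isTriangle x y z) (adj T x w)))
                                  (sym (∑-distribˡ-* (𝟙 (isTriangle x y z)) V (𝟙 ∘ adj T x)))
      factor-triangles : ∀ x → triangles x * degree x ≡ ∑[ y ∈ V ] ∑[ z ∈ V ] 𝟙 (isTriangle x y z) * degree x
      factor-triangles x = trans (∑-distribʳ-* (degree x) V _)
                                 (∑-cong V (λ y → ∑-distribʳ-* (degree x) V (𝟙 ∘ isTriangle x y)))

    triangles≤degree² : ∀ x → triangles x ≤ degree x * degree x
    triangles≤degree² x = begin
      triangles x
        ≤⟨ ∑-mono-≤ V (λ y → ∑-mono-≤ V (λ z → 𝟙-∧-∧≤ (adj T x y) (adj T x z) (adj T y z))) ⟩
      ∑[ y ∈ V ] ∑[ z ∈ V ] 𝟙 (adj T x y) * 𝟙 (adj T x z)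
        ≡⟨ sym (∑-*-∑ V V (𝟙 ∘ adj T x) (𝟙 ∘ adj T x)) ⟩
      degree x * degree x
        ∎
      where
      open ≤-Reasoning
      V = allFin (v T)
      𝟙-∧-∧≤ : ∀ a b c → 𝟙 (a ∧ b ∧ c) ≤ 𝟙 a * 𝟙 b
      𝟙-∧-∧≤ false b     c = z≤n
      𝟙-∧-∧≤ true  false c = z≤n
      𝟙-∧-∧≤ true  true  c = 𝟙≤1 c

    hom-K3³≤v*hom-TrianglePendant² : hom K3 T ^ 3 ≤ v T * hom TrianglePendant T ^ 2
    hom-K3³≤v*hom-TrianglePendant² = begin
      hom K3 T ^ 3
        ≡⟨ cong (_^ 3) hom-K3 ⟩
      (∑[ x ∈ V ] triangles x) ^ 3
        ≤⟨ cube-∑≤length*square-∑ V triangles (λ x → triangles x * degree x)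
                                  (λ x → m≤n²⇒m³≤[m*n]² (triangles≤degree² x)) ⟩
      length V * (∑[ x ∈ V ] triangles x * degree x) ^ 2
        ≡⟨ cong₂ (λ ℓ w → ℓ * w ^ 2) (length-allFin (v T)) (sym hom-TrianglePendant) ⟩
      v T * hom TrianglePendant T ^ 2
        ∎
      where
      open ≤-Reasoning
      V = allFin (v T)

module Fraction where

  open import Defs using (_^_)
  open import Data.Nat as ℕ using (zero; suc; NonZero; z<s)
  open import Data.Nat.Properties using (m*n≢0; m^n≢0)
  open import Data.Integer as ℤ using (+_; +≤+; +<+)
  open import Data.Integer.Properties using (pos-*)
  open import Data.Rational as ℚ using (ℚ; 0ℚ; toℚᵘ)
  open import Data.Rational.Properties using (toℚᵘ-fromℚᵘ; toℚᵘ-homo-*; toℚᵘ-cancel-≤; toℚᵘ-cancel-<)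
  open import Data.Rational.Unnormalised as ℚᵘ using (mkℚᵘ; _≃_; *≡*; *≤*; *<*)
  open import Data.Rational.Unnormalised.Properties
    using (≃-refl; ≃-sym; ≃-trans; ≃-reflexive; /-cong; *-cong; *-cancelˡ-/;
           ≤-respˡ-≃; ≤-respʳ-≃; <-respˡ-≃; <-respʳ-≃)
  open import Relation.Binary.PropositionalEquality using (refl; sym; cong; subst₂)

  -- x = a / b, witnessed in ℚᵘ, where products and comparisons involve no gcd normalisation.
  IsFraction : ℚ → ℕ → (b : ℕ) → .{{NonZero b}} → Set
  IsFraction x a b = toℚᵘ x ≃ (+ a) ℚᵘ./ b

  /-isFraction : ∀ a b .{{_ : NonZero b}} → IsFraction ((+ a) ℚ./ b) a b
  /-isFraction a (suc b) = toℚᵘ-fromℚᵘ (mkℚᵘ (+ a) b)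

  *-isFraction : ∀ {x y a b c d} .{{_ : NonZero b}} .{{_ : NonZero d}} →
                 IsFraction x a b → IsFraction y c d → IsFraction (x ℚ.* y) (a ℕ.* c) (b ℕ.* d) {{m*n≢0 b d}}
  *-isFraction {x} {y} {a} {suc b} {c} {suc d} x≈ y≈ =
    ≃-trans (toℚᵘ-homo-* x y)
            (≃-trans (*-cong x≈ y≈) (*≡* (cong (ℤ._* + (suc b ℕ.* suc d)) (sym (pos-* a c)))))

  ^-isFraction : ∀ {x a b} .{{_ : NonZero b}} → IsFraction x a b →
                 ∀ k → IsFraction (x ^ k) (a ℕ.^ k) (b ℕ.^ k) {{m^n≢0 b k}}
  ^-isFraction x≈ zero        = ≃-refl
  ^-isFraction {b = b} x≈ (suc k) = *-isFraction {{_}} {{m^n≢0 b k}} x≈ (^-isFraction x≈ k)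

  isFraction-cancelˡ : ∀ c {x a b} .{{_ : NonZero c}} .{{_ : NonZero b}} →
                       IsFraction x (c ℕ.* a) (c ℕ.* b) {{m*n≢0 c b}} → IsFraction x a b
  isFraction-cancelˡ c {a = a} {b} x≈ =
    ≃-trans x≈ (≃-trans (≃-reflexive (/-cong (pos-* c a) refl)) (*-cancelˡ-/ c))
    where instance _ = m*n≢0 c b

  isFraction-≤ : ∀ {x y a b c d} .{{_ : NonZero b}} .{{_ : NonZero d}} →
                 IsFraction x a b → IsFraction y c d → a ℕ.* d ℕ.≤ c ℕ.* b → x ℚ.≤ y
  isFraction-≤ {a = a} {suc b} {c} {suc d} x≈ y≈ ad≤cb =
    toℚᵘ-cancel-≤ (≤-respˡ-≃ (≃-sym x≈) (≤-respʳ-≃ (≃-sym y≈)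
      (*≤* (subst₂ ℤ._≤_ (pos-* a (suc d)) (pos-* c (suc b)) (+≤+ ad≤cb)))))

  isFraction-< : ∀ {x y a b c d} .{{_ : NonZero b}} .{{_ : NonZero d}} →
                 IsFraction x a b → IsFraction y c d → a ℕ.* d ℕ.< c ℕ.* b → x ℚ.< y
  isFraction-< {a = a} {suc b} {c} {suc d} x≈ y≈ ad<cb =
    toℚᵘ-cancel-< (<-respˡ-≃ (≃-sym x≈) (<-respʳ-≃ (≃-sym y≈)
      (*<* (subst₂ ℤ._<_ (pos-* a (suc d)) (pos-* c (suc b)) (+<+ ad<cb)))))

  isFraction-positive : ∀ {x a b} .{{_ : NonZero b}} → IsFraction x (suc a) b → 0ℚ ℚ.< x
  isFraction-positive x≈ = isFraction-< {a = 0} {b = 1} ≃-refl x≈ z<s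

-- The disjoint union of the triangles {i, σ i, σ² i} formed by the orbits of σ.
module TriangleFactor {n : ℕ} (σ : Fin n → Fin n) (σ³≡id : ∀ i → σ (σ (σ i)) ≡ i)
                      (σ-fixedPointFree : ∀ i → σ i ≢ i) where

  open import Defs using (Graph; K3; TrianglePendant; hom; t)
  open import Data.Bool using (Bool; true; false; _∧_; _∨_)
  open import Data.Bool.Properties using (∨-comm; ∨-zeroʳ)
  open import Data.Fin.Properties using (_≟_)
  open import Data.List using (allFin)
  open import Data.Nat as ℕ using (NonZero; _+_; _*_)
  open import Data.Nat.Properties using (*-identityʳ; m^n≢0)
  open import Function using (_∘_; _⇔_; mk⇔)
  open import Relation.Binary.PropositionalEquality
  open import Relation.Nullary.Decidable using (does; dec-true; dec-false; does-⇔)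
  open ListSum
  open HomomorphismCount
  open Fraction

  adjacent : Fin n → Fin n → Bool
  adjacent i j = does (j ≟ σ i) ∨ does (j ≟ σ (σ i))

  σ²-fixedPointFree : ∀ i → σ (σ i) ≢ i
  σ²-fixedPointFree i σ²i≡i = σ-fixedPointFree i (trans (cong σ (sym σ²i≡i)) (σ³≡id i))

  σ≢σ² : ∀ i → σ i ≢ σ (σ i)
  σ≢σ² i σi≡σ²i = σ-fixedPointFree i (begin
    σ i                 ≡⟨ cong σ (sym (σ³≡id i)) ⟩
    σ (σ (σ (σ i)))     ≡⟨ cong (σ ∘ σ) (sym σi≡σ²i) ⟩
    σ (σ (σ i))         ≡⟨ σ³≡id i ⟩
    i                   ∎)
    where open ≡-Reasoning

  j≡σi⇔i≡σ²j : ∀ i j → j ≡ σ i ⇔ i ≡ σ (σ j)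
  j≡σi⇔i≡σ²j i j = mk⇔ (λ j≡σi → trans (sym (σ³≡id i)) (cong (σ ∘ σ) (sym j≡σi)))
                       (λ i≡σ²j → trans (sym (σ³≡id j)) (cong σ (sym i≡σ²j)))

  adjacent-sym : ∀ i j → adjacent i j ≡ adjacent j i
  adjacent-sym i j =
    trans (cong₂ _∨_ (does-⇔ (j≡σi⇔i≡σ²j i j) (j ≟ σ i) (i ≟ σ (σ j)))
                     (sym (does-⇔ (j≡σi⇔i≡σ²j j i) (i ≟ σ j) (j ≟ σ (σ i)))))
          (∨-comm (does (i ≟ σ (σ j))) (does (i ≟ σ j)))

  adjacent-irrefl : ∀ i → adjacent i i ≡ false
  adjacent-irrefl i = cong₂ _∨_ (dec-false (i ≟ σ i) (σ-fixedPointFree i ∘ sym))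
                                (dec-false (i ≟ σ (σ i)) (σ²-fixedPointFree i ∘ sym))

  adjacent-σ : ∀ i → adjacent i (σ i) ≡ true
  adjacent-σ i = cong (_∨ does (σ i ≟ σ (σ i))) (dec-true (σ i ≟ σ i) refl)

  adjacent-σ² : ∀ i → adjacent i (σ (σ i)) ≡ true
  adjacent-σ² i = trans (cong (does (σ (σ i) ≟ σ i) ∨_) (dec-true (σ (σ i) ≟ σ (σ i)) refl)) (∨-zeroʳ _)

  triangleFactor : Graph
  triangleFactor = record { v = n ; adj = adjacent ; sym = adjacent-sym ; irrefl = adjacent-irrefl }

  ∑-neighbours : ∀ i (h : Fin n → ℕ) → ∑[ x ∈ allFin n ] 𝟙 (adjacent i x) * h x ≡ h (σ i) + h (σ (σ i))
  ∑-neighbours i = ∑-indicator-pair (σ≢σ² i)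

  degree-triangleFactor : ∀ i → degree triangleFactor i ≡ 2
  degree-triangleFactor i =
    trans (∑-cong (allFin n) (λ x → sym (*-identityʳ (𝟙 (adjacent i x))))) (∑-neighbours i (λ _ → 1))

  triangles-triangleFactor : ∀ i → triangles triangleFactor i ≡ 2
  triangles-triangleFactor i = begin
    triangles triangleFactor i
      ≡⟨ ∑-cong V (λ y → trans (∑-cong V (λ z → 𝟙-∧∧ (adjacent i y) (adjacent i z) (adjacent y z)))
                               (sym (∑-distribˡ-* (𝟙 (adjacent i y)) V _))) ⟩
    ∑[ y ∈ V ] 𝟙 (adjacent i y) * (∑[ z ∈ V ] 𝟙 (adjacent i z) * 𝟙 (adjacent y z))
      ≡⟨ ∑-cong V (λ y → cong (𝟙 (adjacent i y) *_) (∑-neighbours i (𝟙 ∘ adjacent y))) ⟩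
    ∑[ y ∈ V ] 𝟙 (adjacent i y) * (𝟙 (adjacent y a) + 𝟙 (adjacent y b))
      ≡⟨ ∑-neighbours i (λ y → 𝟙 (adjacent y a) + 𝟙 (adjacent y b)) ⟩
    (𝟙 (adjacent a a) + 𝟙 (adjacent a b)) + (𝟙 (adjacent b a) + 𝟙 (adjacent b b))
      ≡⟨ cong₂ _+_ (cong₂ _+_ (cong 𝟙 (adjacent-irrefl a)) (cong 𝟙 (adjacent-σ a)))
                   (cong₂ _+_ (cong 𝟙 b~a) (cong 𝟙 (adjacent-irrefl b))) ⟩
    2 ∎
    where
    open ≡-Reasoning
    V = allFin n
    a = σ i
    b = σ (σ i)
    b~a : adjacent b a ≡ true
    b~a = trans (cong (adjacent b) (cong σ (sym (σ³≡id i)))) (adjacent-σ² b)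
    𝟙-∧∧ : ∀ p q r → 𝟙 (p ∧ q ∧ r) ≡ 𝟙 p * (𝟙 q * 𝟙 r)
    𝟙-∧∧ p q r = trans (𝟙-∧ p (q ∧ r)) (cong (𝟙 p *_) (𝟙-∧ q r))

  hom-K3-triangleFactor : hom K3 triangleFactor ≡ n * 2
  hom-K3-triangleFactor =
    trans (hom-K3 triangleFactor)
          (trans (∑-cong (allFin n) triangles-triangleFactor)
                 (trans (∑-const (allFin n) 2) (cong (_* 2) (length-allFin n))))

  hom-TrianglePendant-triangleFactor : hom TrianglePendant triangleFactor ≡ n * 4
  hom-TrianglePendant-triangleFactor =
    trans (hom-TrianglePendant triangleFactor)
          (trans (∑-cong (allFin n) (λ i → cong₂ _*_ (triangles-triangleFactor i) (degree-triangleFactor i)))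
                 (trans (∑-const (allFin n) 4) (cong (_* 4) (length-allFin n))))

  module _ .{{_ : NonZero n}} where

    private instance
      n²≢0 : NonZero (n ℕ.^ 2)
      n²≢0 = m^n≢0 n 2
      n³≢0 : NonZero (n ℕ.^ 3)
      n³≢0 = m^n≢0 n 3
      n⁴≢0 : NonZero (n ℕ.^ 4)
      n⁴≢0 = m^n≢0 n 4

    t-K3-triangleFactor : IsFraction (t K3 triangleFactor) 2 (n ℕ.^ 2)
    t-K3-triangleFactor =
      isFraction-cancelˡ n (subst (λ h → IsFraction (t K3 triangleFactor) h (n ℕ.^ 3)) hom-K3-triangleFactor
                                  (/-isFraction (hom K3 triangleFactor) (n ℕ.^ 3)))

    t-TrianglePendant-triangleFactor : IsFraction (t TrianglePendant triangleFactor) 4 (n ℕ.^ 3)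
    t-TrianglePendant-triangleFactor =
      isFraction-cancelˡ n (subst (λ h → IsFraction (t TrianglePendant triangleFactor) h (n ℕ.^ 4))
                                  hom-TrianglePendant-triangleFactor
                                  (/-isFraction (hom TrianglePendant triangleFactor) (n ℕ.^ 4)))

module DisjointTriangles where

  open import Data.Fin using (combine; remQuot)
  open import Data.Fin.Patterns using (0F; 1F; 2F)
  open import Data.Fin.Properties using (remQuot-combine; combine-surjective; combine-injectiveʳ)
  open import Data.Nat using (_*_)
  open import Data.Product using (_,_; uncurry; map₂)
  open import Function using (_∘_)
  open import Relation.Binary.PropositionalEquality

  rotate : Fin 3 → Fin 3
  rotate 0F = 1F
  rotate 1F = 2F
  rotate 2F = 0F

  rotate³≡id : ∀ r → rotate (rotate (rotate r)) ≡ r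
  rotate³≡id 0F = refl
  rotate³≡id 1F = refl
  rotate³≡id 2F = refl

  rotate-fixedPointFree : ∀ r → rotate r ≢ r
  rotate-fixedPointFree 0F ()
  rotate-fixedPointFree 1F ()
  rotate-fixedPointFree 2F ()

  module _ (k : ℕ) where

    rotateBlocks : Fin (k * 3) → Fin (k * 3)
    rotateBlocks = uncurry (combine {k}) ∘ map₂ rotate ∘ remQuot 3

    rotateBlocks-combine : ∀ b r → rotateBlocks (combine b r) ≡ combine b (rotate r)
    rotateBlocks-combine b r = cong (uncurry combine ∘ map₂ rotate) (remQuot-combine {k} {3} b r)

    rotateBlocks³≡id : ∀ i → rotateBlocks (rotateBlocks (rotateBlocks i)) ≡ i
    rotateBlocks³≡id i with combine-surjective {k} {3} i
    ... | b , r , refl = begin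
      ρ (ρ (ρ (combine b r)))              ≡⟨ cong (ρ ∘ ρ) (rotateBlocks-combine b r) ⟩
      ρ (ρ (combine b (rotate r)))          ≡⟨ cong ρ (rotateBlocks-combine b (rotate r)) ⟩
      ρ (combine b (rotate (rotate r)))     ≡⟨ rotateBlocks-combine b (rotate (rotate r)) ⟩
      combine b (rotate (rotate (rotate r))) ≡⟨ cong (combine b) (rotate³≡id r) ⟩
      combine b r                            ∎
      where
      open ≡-Reasoning
      ρ = rotateBlocks

    rotateBlocks-fixedPointFree : ∀ i → rotateBlocks i ≢ i
    rotateBlocks-fixedPointFree i with combine-surjective {k} {3} i
    ... | b , r , refl =
      rotate-fixedPointFree r ∘ combine-injectiveʳ b (rotate r) b r ∘ trans (sym (rotateBlocks-combine b r))

    open TriangleFactor rotateBlocks rotateBlocks³≡id rotateBlocks-fixedPointFree public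
      using ()
      renaming ( triangleFactor to disjointTriangles
               ; t-K3-triangleFactor to t-K3-disjointTriangles
               ; t-TrianglePendant-triangleFactor to t-TrianglePendant-disjointTriangles
               )

module ExponentComparison where

  open import Data.Nat using (suc; NonZero; _*_; _^_; _≤_; _<_; >-nonZero⁻¹; s≤s; z≤n)
  open import Data.Nat.Properties
    using (m*n≢0; m^n≢0; m^n>0; *-comm; *-identityʳ; ^-*-assoc; ^-monoʳ-≤; ^-monoˡ-≤;
           *-monoˡ-<; *-monoʳ-≤; m≤n*m; ≤-trans; <-≤-trans; module ≤-Reasoning)
  open import Relation.Binary.PropositionalEquality

  module _ (q : ℕ) .{{_ : NonZero q}} (n : ℕ) .{{_ : NonZero n}} (4^q<n : 4 ^ q < n) where

    private instance
      n²≢0 : NonZero (n ^ 2)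
      n²≢0 = m^n≢0 n 2

    4^q*[n²]^m<2^m*[n³]^q : ∀ m → m * 2 < 3 * q → 4 ^ q * (n ^ 2) ^ m < 2 ^ m * (n ^ 3) ^ q
    4^q*[n²]^m<2^m*[n³]^q m 2m<3q = begin-strict
      4 ^ q * (n ^ 2) ^ m   <⟨ *-monoˡ-< ((n ^ 2) ^ m) {{m^n≢0 (n ^ 2) m}} 4^q<n ⟩
      n * (n ^ 2) ^ m       ≡⟨ cong (n *_) (^-*-assoc n 2 m) ⟩
      n ^ suc (2 * m)       ≤⟨ ^-monoʳ-≤ n (subst (_< 3 * q) (*-comm m 2) 2m<3q) ⟩
      n ^ (3 * q)           ≡⟨ ^-*-assoc n 3 q ⟨
      (n ^ 3) ^ q           ≤⟨ m≤n*m ((n ^ 3) ^ q) (2 ^ m) {{m^n≢0 2 m}} ⟩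
      2 ^ m * (n ^ 3) ^ q   ∎
      where open ≤-Reasoning

    4^q*2^[1+m]<[n³]^q*[n²]^[1+m] : ∀ m → 4 ^ q * 2 ^ suc m < (n ^ 3) ^ q * (n ^ 2) ^ suc m
    4^q*2^[1+m]<[n³]^q*[n²]^[1+m] m = begin-strict
      4 ^ q * 2 ^ suc m             <⟨ *-monoˡ-< (2 ^ suc m) {{m^n≢0 2 (suc m)}} (<-≤-trans 4^q<n n≤[n³]^q) ⟩
      (n ^ 3) ^ q * 2 ^ suc m       ≤⟨ *-monoʳ-≤ ((n ^ 3) ^ q) (^-monoˡ-≤ (suc m) 2≤n²) ⟩
      (n ^ 3) ^ q * (n ^ 2) ^ suc m ∎
      where
      open ≤-Reasoning
      n≤[n³]^q : n ≤ (n ^ 3) ^ q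
      n≤[n³]^q = begin
        n             ≡⟨ *-identityʳ n ⟨
        n ^ 1         ≤⟨ ^-monoʳ-≤ n (>-nonZero⁻¹ (3 * q) {{m*n≢0 3 q}}) ⟩
        n ^ (3 * q)   ≡⟨ ^-*-assoc n 3 q ⟨
        (n ^ 3) ^ q   ∎
      2≤n² : 2 ≤ n ^ 2
      2≤n² = begin
        2             ≤⟨ ≤-trans (s≤s (m^n>0 4 q)) 4^q<n ⟩
        n             ≡⟨ *-identityʳ n ⟨
        n ^ 1         ≤⟨ ^-monoʳ-≤ n {1} {2} (s≤s z≤n) ⟩
        n ^ 2         ∎

module DensityComparison where

  open import Defs using (Graph; v; hom; t; K3; TrianglePendant; _^_; PowExceeds)
  open import Data.Integer as ℤ using (+_; -[1+_])
  open import Data.Integer.Properties using (pos-*; drop‿+<+)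
  open import Data.Nat as ℕ using (suc; NonZero; _*_; _<_; s≤s; z≤n)
  open import Data.Nat.Properties
    using (m*n≢0; m^n≢0; *-identityˡ; *-identityʳ; *-monoˡ-≤; m<m*n; module ≤-Reasoning)
  open import Data.Nat.Solver using (module +-*-Solver)
  open import Data.Rational as ℚ using (0ℚ)
  open import Data.Rational.Unnormalised.Properties using (≃-refl)
  open import Relation.Binary.PropositionalEquality
  open +-*-Solver using (solve; _:*_; _:^_; _:=_)
  open Fraction
  open HomomorphismCount using (hom-K3³≤v*hom-TrianglePendant²)
  open ExponentComparison
  open DisjointTriangles

  module _ (q : ℕ) .{{_ : NonZero q}} (n : ℕ) .{{_ : NonZero n}} (4^q<n : 4 ℕ.^ q < n) where

    private instance
      n²≢0 : NonZero (n ℕ.^ 2)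
      n²≢0 = m^n≢0 n 2
      n³≢0 : NonZero (n ℕ.^ 3)
      n³≢0 = m^n≢0 n 3

    powExceeds : ∀ {a x} → IsFraction a 4 (n ℕ.^ 3) → IsFraction x 2 (n ℕ.^ 2) →
                 ∀ p → p ℤ.* + 2 ℤ.< + (3 * q) → PowExceeds a x p q
    powExceeds a≈ x≈ (+ m) 2m<3q =
      isFraction-< (^-isFraction a≈ q) (^-isFraction x≈ m) (4^q*[n²]^m<2^m*[n³]^q q n 4^q<n m m*2<3q)
      where
      instance
        _ = m^n≢0 (n ℕ.^ 3) q
        _ = m^n≢0 (n ℕ.^ 2) m
      m*2<3q : m * 2 < 3 * q
      m*2<3q = drop‿+<+ (subst (ℤ._< + (3 * q)) (sym (pos-* m 2)) 2m<3q)
    powExceeds a≈ x≈ -[1+ m ] _ =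
      isFraction-< (*-isFraction (^-isFraction a≈ q) (^-isFraction x≈ (suc m))) ≃-refl
                   (subst₂ _<_ (sym (*-identityʳ _)) (sym (*-identityˡ _))
                           (4^q*2^[1+m]<[n³]^q*[n²]^[1+m] q n 4^q<n m))
      where
      instance
        _ = m^n≢0 (n ℕ.^ 3) q
        _ = m^n≢0 (n ℕ.^ 2) (suc m)
        _ = m*n≢0 ((n ℕ.^ 3) ℕ.^ q) ((n ℕ.^ 2) ℕ.^ suc m)

  t-K3³≤t-TrianglePendant² : (T : Graph) → .{{_ : NonZero (v T)}} → t K3 T ^ 3 ℚ.≤ t TrianglePendant T ^ 2
  t-K3³≤t-TrianglePendant² T =
    isFraction-≤ (^-isFraction (/-isFraction S (n ℕ.^ 3)) 3) (^-isFraction (/-isFraction W (n ℕ.^ 4)) 2) (begin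
      S ℕ.^ 3 * (n ℕ.^ 4) ℕ.^ 2       ≤⟨ *-monoˡ-≤ ((n ℕ.^ 4) ℕ.^ 2) (hom-K3³≤v*hom-TrianglePendant² T) ⟩
      n * W ℕ.^ 2 * (n ℕ.^ 4) ℕ.^ 2   ≡⟨ rearrange n W ⟩
      W ℕ.^ 2 * (n ℕ.^ 3) ℕ.^ 3       ∎)
    where
    open ≤-Reasoning
    n = v T
    S = hom K3 T
    W = hom TrianglePendant T
    instance
      _ = m^n≢0 n 3
      _ = m^n≢0 n 4
      _ = m^n≢0 (n ℕ.^ 3) 3
      _ = m^n≢0 (n ℕ.^ 4) 2
    rearrange : ∀ n w → n * w ℕ.^ 2 * (n ℕ.^ 4) ℕ.^ 2 ≡ w ℕ.^ 2 * (n ℕ.^ 3) ℕ.^ 3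
    rearrange = solve 2 (λ n w → n :* w :^ 2 :* (n :^ 4) :^ 2 := w :^ 2 :* (n :^ 3) :^ 3) refl

  module _ (q : ℕ) .{{_ : NonZero q}} where

    private
      k N : ℕ
      k = 4 ℕ.^ q
      N = k * 3
      instance
        k≢0 : NonZero k
        k≢0 = m^n≢0 4 q

    instance
      v-disjointTriangles≢0 : NonZero (v (disjointTriangles k))
      v-disjointTriangles≢0 = m*n≢0 k 3

    private instance
      N²≢0 : NonZero (N ℕ.^ 2)
      N²≢0 = m^n≢0 N 2
      N³≢0 : NonZero (N ℕ.^ 3)
      N³≢0 = m^n≢0 N 3

    t-K3-disjointTriangles-positive : 0ℚ ℚ.< t K3 (disjointTriangles k)
    t-K3-disjointTriangles-positive = isFraction-positive (t-K3-disjointTriangles k)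

    disjointTriangles-powExceeds : ∀ p → p ℤ.* + 2 ℤ.< + (3 * q) →
                                   PowExceeds (t TrianglePendant (disjointTriangles k)) (t K3 (disjointTriangles k)) p q
    disjointTriangles-powExceeds =
      powExceeds q N (m<m*n k 3 (s≤s (s≤s z≤n))) (t-TrianglePendant-disjointTriangles k) (t-K3-disjointTriangles k)

open import Defs
open import Data.Nat using (ℕ; NonZero)
open import Data.Integer using (ℤ; +_)
open import Data.Rational using (_≤_; _<_; 0ℚ)
open import Data.Product using (Σ; _×_; _,_)
open DisjointTriangles using (disjointTriangles)
open DensityComparison

theorem5p4 :
    ((T : Graph) → .{{_ : NonZero (v T)}} →
       (t K3 T ^ 3) ≤ (t TrianglePendant T ^ 2))
    ×
    ((p : ℤ) (q : ℕ) → .{{_ : NonZero q}} →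
       (p Data.Integer.* + 2) Data.Integer.< (+ (3 Data.Nat.* q)) →
       Σ Graph λ T → Σ (NonZero (v T)) λ nz →
         (0ℚ < t K3 T {{nz}}) × PowExceeds (t TrianglePendant T {{nz}}) (t K3 T {{nz}}) p q)
theorem5p4 = t-K3³≤t-TrianglePendant² , λ p q 2p<3q →
  disjointTriangles (4 Data.Nat.^ q) , v-disjointTriangles≢0 q , t-K3-disjointTriangles-positive q ,
  disjointTriangles-powExceeds q p 2p<3q
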